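{- Let $p$ be prime and $k_1,\ldots,k_j$ be positive integers. Then there exists a vertex-transitive digraph $\Gamma$ whose automorphism group is ${\mathbb Z}_{p^{k_1}}\wr\cdots\wr{\mathbb Z}_{p^{k_j}}$. Furthermore, we can choose $\Gamma=\Gamma_1\wr\cdots\wr\Gamma_j$, where each $\Gamma_i$ is a circulant digraph on ${\mathbb Z}_{p^{k_i}}$.
   Context: Each ${\mathbb Z}_m$ acts regularly on itself. For permutation groups $A$ on $X$ and $B$ on $Y$, $A\wr B$ is the set of permutations of $X\times Y$ of the form $(x,y)\mapsto(a(x),b_x(y))$ with $a\in A$ and $b_x\in B$ for each $x$; iterated products are formed the same way. For digraphs, $\Gamma_1\wr\Gamma_2$ has vertex set $V(\Gamma_1)\times V(\Gamma_2)$ and arcs $((u,v),(u,v'))$ for $(v,v')\in E(\Gamma_2)$, and $((u,v),(u',v'))$ for $(u,u')\in E(\Gamma_1)$ and arbitrary $v,v'$. A circulant digraph on ${\mathbb Z}_m$ is a Cayley digraph ${\rm Cay}({\mathbb Z}_m,S)$ (vertex set ${\mathbb Z}_m$, arcs $(g,g+s)$, $s\in S$). -}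

module Defs where

open import Data.Nat using (ℕ; zero; suc; _+_)
open import Data.Nat.DivMod using (_mod_)
open import Data.Fin using (Fin; toℕ)
open import Data.Bool using (Bool; true)
open import Data.Product using (Σ; _×_; _,_)
open import Data.Sum using (_⊎_)
open import Function using (_∘_)
open import Function.Bundles using (_⇔_)
open import Function.Definitions using (Bijective)
open import Relation.Binary.PropositionalEquality using (_≡_)

-- Addition in ℤ_m, realised on Fin m (m = 0 is vacuous: Fin 0 is empty).
_⊕_ : {m : ℕ} → Fin m → Fin m → Fin m
_⊕_ {suc n} u s = (toℕ u + toℕ s) mod suc n

Digraph : Set → Set₁
Digraph V = V → V → Set

Cay : (m : ℕ) → (Fin m → Bool) → Digraph (Fin m)
Cay m S g h = Σ (Fin m) λ s → (S s ≡ true) × (h ≡ g ⊕ s)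

_≀ᵈ_ : {X Y : Set} → Digraph X → Digraph Y → Digraph (X × Y)
(Γ₁ ≀ᵈ Γ₂) (u , v) (u' , v') = ((u ≡ u') × Γ₂ v v') ⊎ Γ₁ u u'

IsAut : {V : Set} → Digraph V → (V → V) → Set
IsAut Γ f = Bijective _≡_ _≡_ f × (∀ u v → Γ u v ⇔ Γ (f u) (f v))

VertexTransitive : {V : Set} → Digraph V → Set
VertexTransitive {V} Γ = ∀ u v → Σ (V → V) λ f → IsAut Γ f × (f u ≡ v)

PermGroup : Set → Set₁
PermGroup X = (X → X) → Set

Cyc : (m : ℕ) → PermGroup (Fin m)
Cyc m f = Σ (Fin m) λ a → ∀ x → f x ≡ x ⊕ a

_≀ᵍ_ : {X Y : Set} → PermGroup X → PermGroup Y → PermGroup (X × Y)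
(_≀ᵍ_ {X} {Y} A B) f =
  Σ (X → X) λ a → Σ (X → Y → Y) λ b →
    A a × (∀ x → B (b x)) × (∀ x y → f (x , y) ≡ (a x , b x y))

-- Iterated products over factors indexed by Fin (suc j)
-- (j here = number of factors minus one), bracketed as
-- F₀ ≀ (F₁ ≀ (⋯ ≀ F_j)).

Vert : (j : ℕ) → (Fin (suc j) → Set) → Set
Vert zero X = X Fin.zero
Vert (suc j) X = X Fin.zero × Vert j (X ∘ Fin.suc)

WreathD : (j : ℕ) (X : Fin (suc j) → Set) → ((i : Fin (suc j)) → Digraph (X i)) → Digraph (Vert j X)
WreathD zero X Γ = Γ Fin.zero
WreathD (suc j) X Γ = Γ Fin.zero ≀ᵈ WreathD j (X ∘ Fin.suc) (Γ ∘ Fin.suc)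

WreathG : (j : ℕ) (X : Fin (suc j) → Set) → ((i : Fin (suc j)) → PermGroup (X i)) → PermGroup (Vert j X)
WreathG zero X G = G Fin.zero
WreathG (suc j) X G = G Fin.zero ≀ᵍ WreathG j (X ∘ Fin.suc) (G ∘ Fin.suc)

-- Aut (Γ₁ ≀ Γ₂) = Aut Γ₁ ≀ Aut Γ₂ as soon as Γ₁ is loopless and every automorphism of
-- Γ₁ ≀ Γ₂ maps fibres {x} × V(Γ₂) to fibres.  The directed cycle on ℤ_m has automorphism
-- group ℤ_m, and so has the edgeless digraph when m = 2.  For m ≥ 3, two vertices of
-- Cycle ≀ Γ₂ are in the same fibre iff they lie in a common out-module having a common
-- out-neighbour outside it, a property invariant under automorphisms.  For m = 2 the
-- fibres are the components (edgeless factor, Γ₂ connected) or the co-components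
-- (K₂ factor, Γ₂ co-connected); the product is again co-connected resp. connected, so
-- one of the two factors is always available at the next level of the iterated product.
-- Vertex-transitivity holds because wreath products of transitive groups are transitive.
module Submission where

open import Defs
open import Data.Nat using (ℕ; zero; suc; _+_; _∸_; _≤_; _<_; _^_; _≡ᵇ_; s≤s)
open import Data.Nat.Properties
  using (+-comm; +-assoc; +-identityʳ; m+[n∸m]≡n; <⇒≤; ≤-trans; ^-monoʳ-≤; ^-monoˡ-≤; ≡ᵇ⇒≡)
open import Data.Nat.Base using (nonTrivial⇒n>1)
open import Data.Nat.DivMod using (_%_; _mod_; m%n<n; m%n%n≡m%n; %-distribˡ-+; n%n≡0; m<n⇒m%n≡m)
open import Data.Nat.Primality using (Prime; prime⇒nonTrivial)
open import Data.Fin using (Fin; toℕ; fromℕ<)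
open import Data.Fin.Properties using (toℕ-injective; toℕ<n; toℕ-fromℕ<; 0≢1+n; _≟_)
open import Data.Bool using (Bool; true; false; T)
open import Data.Unit using (tt)
open import Data.Empty using (⊥; ⊥-elim)
open import Data.Product using (Σ; _×_; _,_; proj₁; proj₂)
open import Data.Sum using (_⊎_; inj₁; inj₂)
open import Function using (_∘_)
open import Function.Bundles using (_⇔_; mk⇔; Equivalence)
open import Function.Construct.Composition using (_⇔-∘_)
open import Function.Construct.Symmetry using (⇔-sym)
open import Relation.Nullary using (¬_; yes; no)
open import Relation.Binary.Construct.Closure.ReflexiveTransitive
  using (Star; ε; _◅_; _◅◅_; gmap; fold; reverse)
open import Relation.Binary.Construct.Closure.Symmetric using (SymClosure; fwd; bwd; symmetric)
import Relation.Binary.Construct.Closure.Symmetric as SymClosure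
open import Relation.Binary.PropositionalEquality

module _ {n : ℕ} where

  %-absorbˡ : ∀ a b → (a % suc n + b) % suc n ≡ (a + b) % suc n
  %-absorbˡ a b = begin
    (a % suc n + b) % suc n                 ≡⟨ %-distribˡ-+ (a % suc n) b (suc n) ⟩
    (a % suc n % suc n + b % suc n) % suc n ≡⟨ cong (λ r → (r + b % suc n) % suc n) (m%n%n≡m%n a (suc n)) ⟩
    (a % suc n + b % suc n) % suc n         ≡⟨ %-distribˡ-+ a b (suc n) ⟨
    (a + b) % suc n                         ∎
    where open ≡-Reasoning

  %-absorbʳ : ∀ a b → (a + b % suc n) % suc n ≡ (a + b) % suc n
  %-absorbʳ a b = begin
    (a + b % suc n) % suc n ≡⟨ cong (_% suc n) (+-comm a (b % suc n)) ⟩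
    (b % suc n + a) % suc n ≡⟨ %-absorbˡ b a ⟩
    (b + a) % suc n         ≡⟨ cong (_% suc n) (+-comm b a) ⟩
    (a + b) % suc n         ∎
    where open ≡-Reasoning

  mod-cong : ∀ a b → a % suc n ≡ b % suc n → a mod suc n ≡ b mod suc n
  mod-cong _ _ e = toℕ-injective (trans (toℕ-fromℕ< _) (trans e (sym (toℕ-fromℕ< _))))

  toℕ-⊕ : (x y : Fin (suc n)) → toℕ (x ⊕ y) ≡ (toℕ x + toℕ y) % suc n
  toℕ-⊕ x y = toℕ-fromℕ< _

  ⊕-comm : (x y : Fin (suc n)) → x ⊕ y ≡ y ⊕ x
  ⊕-comm x y = cong (_mod suc n) (+-comm (toℕ x) (toℕ y))

  ⊕-assoc : (x y z : Fin (suc n)) → (x ⊕ y) ⊕ z ≡ x ⊕ (y ⊕ z)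
  ⊕-assoc x y z = mod-cong (toℕ (x ⊕ y) + toℕ z) (toℕ x + toℕ (y ⊕ z)) (begin
    (toℕ (x ⊕ y) + toℕ z) % suc n             ≡⟨ cong (λ r → (r + toℕ z) % suc n) (toℕ-⊕ x y) ⟩
    ((toℕ x + toℕ y) % suc n + toℕ z) % suc n ≡⟨ %-absorbˡ (toℕ x + toℕ y) (toℕ z) ⟩
    (toℕ x + toℕ y + toℕ z) % suc n           ≡⟨ cong (_% suc n) (+-assoc (toℕ x) (toℕ y) (toℕ z)) ⟩
    (toℕ x + (toℕ y + toℕ z)) % suc n         ≡⟨ %-absorbʳ (toℕ x) (toℕ y + toℕ z) ⟨
    (toℕ x + (toℕ y + toℕ z) % suc n) % suc n ≡⟨ cong (λ r → (toℕ x + r) % suc n) (toℕ-⊕ y z) ⟨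
    (toℕ x + toℕ (y ⊕ z)) % suc n             ∎)
    where open ≡-Reasoning

  ⊕-identityʳ : (x : Fin (suc n)) → x ⊕ Fin.zero ≡ x
  ⊕-identityʳ x = toℕ-injective (begin
    toℕ (x ⊕ Fin.zero)  ≡⟨ toℕ-⊕ x Fin.zero ⟩
    (toℕ x + 0) % suc n ≡⟨ cong (_% suc n) (+-identityʳ (toℕ x)) ⟩
    toℕ x % suc n       ≡⟨ m<n⇒m%n≡m (toℕ<n x) ⟩
    toℕ x               ∎)
    where open ≡-Reasoning

  ⊕-identityˡ : (x : Fin (suc n)) → Fin.zero ⊕ x ≡ x
  ⊕-identityˡ x = trans (⊕-comm Fin.zero x) (⊕-identityʳ x)

  infix 25 ⊖_
  ⊖_ : Fin (suc n) → Fin (suc n)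
  ⊖ x = (suc n ∸ toℕ x) mod suc n

  ⊕-inverseʳ : (x : Fin (suc n)) → x ⊕ ⊖ x ≡ Fin.zero
  ⊕-inverseʳ x = toℕ-injective (begin
    toℕ (x ⊕ ⊖ x)                             ≡⟨ toℕ-⊕ x (⊖ x) ⟩
    (toℕ x + toℕ (⊖ x)) % suc n               ≡⟨ cong (λ r → (toℕ x + r) % suc n) (toℕ-fromℕ< _) ⟩
    (toℕ x + (suc n ∸ toℕ x) % suc n) % suc n ≡⟨ %-absorbʳ (toℕ x) (suc n ∸ toℕ x) ⟩
    (toℕ x + (suc n ∸ toℕ x)) % suc n         ≡⟨ cong (_% suc n) (m+[n∸m]≡n (<⇒≤ (toℕ<n x))) ⟩
    suc n % suc n                             ≡⟨ n%n≡0 (suc n) ⟩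
    0                                         ∎)
    where open ≡-Reasoning

  [x⊕⊖c]⊕c≡x : (x c : Fin (suc n)) → (x ⊕ ⊖ c) ⊕ c ≡ x
  [x⊕⊖c]⊕c≡x x c = begin
    (x ⊕ ⊖ c) ⊕ c  ≡⟨ ⊕-assoc x (⊖ c) c ⟩
    x ⊕ (⊖ c ⊕ c)  ≡⟨ cong (x ⊕_) (⊕-comm (⊖ c) c) ⟩
    x ⊕ (c ⊕ ⊖ c)  ≡⟨ cong (x ⊕_) (⊕-inverseʳ c) ⟩
    x ⊕ Fin.zero   ≡⟨ ⊕-identityʳ x ⟩
    x              ∎
    where open ≡-Reasoning

  [x⊕c]⊕⊖c≡x : (x c : Fin (suc n)) → (x ⊕ c) ⊕ ⊖ c ≡ x
  [x⊕c]⊕⊖c≡x x c = begin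
    (x ⊕ c) ⊕ ⊖ c  ≡⟨ ⊕-assoc x c (⊖ c) ⟩
    x ⊕ (c ⊕ ⊖ c)  ≡⟨ cong (x ⊕_) (⊕-inverseʳ c) ⟩
    x ⊕ Fin.zero   ≡⟨ ⊕-identityʳ x ⟩
    x              ∎
    where open ≡-Reasoning

  ⊕-cancelʳ : ∀ {x y c : Fin (suc n)} → x ⊕ c ≡ y ⊕ c → x ≡ y
  ⊕-cancelʳ {x} {y} {c} e = begin
    x              ≡⟨ [x⊕c]⊕⊖c≡x x c ⟨
    (x ⊕ c) ⊕ ⊖ c  ≡⟨ cong (_⊕ ⊖ c) e ⟩
    (y ⊕ c) ⊕ ⊖ c  ≡⟨ [x⊕c]⊕⊖c≡x y c ⟩
    y              ∎
    where open ≡-Reasoning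

  ⊕-fixed⇒zero : ∀ {x c : Fin (suc n)} → x ⊕ c ≡ x → c ≡ Fin.zero
  ⊕-fixed⇒zero {x} {c} e = ⊕-cancelʳ (trans (⊕-comm c x) (trans e (sym (⊕-identityˡ x))))

  [x⊕y]⊕z≡[x⊕z]⊕y : (x y z : Fin (suc n)) → (x ⊕ y) ⊕ z ≡ (x ⊕ z) ⊕ y
  [x⊕y]⊕z≡[x⊕z]⊕y x y z = begin
    (x ⊕ y) ⊕ z  ≡⟨ ⊕-assoc x y z ⟩
    x ⊕ (y ⊕ z)  ≡⟨ cong (x ⊕_) (⊕-comm y z) ⟩
    x ⊕ (z ⊕ y)  ≡⟨ ⊕-assoc x z y ⟨
    (x ⊕ z) ⊕ y  ∎
    where open ≡-Reasoning

Aut : {V : Set} → Digraph V → PermGroup V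
Aut = IsAut

_HasAutGroup_ : {V : Set} → Digraph V → PermGroup V → Set
Γ HasAutGroup G = ∀ f → Aut Γ f ⇔ G f

IsTransitive : {V : Set} → PermGroup V → Set
IsTransitive {V} G = ∀ u v → Σ (V → V) λ f → G f × f u ≡ v

Loopless : {V : Set} → Digraph V → Set
Loopless Γ = ∀ v → ¬ Γ v v

NonAdjacent : {V : Set} → Digraph V → V → V → Set
NonAdjacent Γ u v = ¬ Γ u v × ¬ Γ v u

Connected : {V : Set} → Digraph V → Set
Connected Γ = ∀ u v → Star (SymClosure Γ) u v

CoConnected : {V : Set} → Digraph V → Set
CoConnected Γ = ∀ u v → Star (NonAdjacent Γ) u v

ConnectedOrCoConnected : {V : Set} → Digraph V → Set
ConnectedOrCoConnected Γ = Connected Γ ⊎ CoConnected Γ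

mkAut : {V : Set} {Γ : Digraph V} {f : V → V} →
        (∀ {u v} → f u ≡ f v → u ≡ v) → (∀ v → Σ V λ u → f u ≡ v) →
        (∀ u v → Γ u v ⇔ Γ (f u) (f v)) → IsAut Γ f
mkAut injective surjective arcs =
  (injective , λ v → proj₁ (surjective v) , λ { refl → proj₂ (surjective v) }) , arcs

module _ {V : Set} {Γ : Digraph V} {f : V → V} (f-aut : IsAut Γ f) where

  aut-injective : ∀ {u v} → f u ≡ f v → u ≡ v
  aut-injective = proj₁ (proj₁ f-aut)

  aut⁻¹ : V → V
  aut⁻¹ v = proj₁ (proj₂ (proj₁ f-aut) v)

  aut-aut⁻¹ : ∀ v → f (aut⁻¹ v) ≡ v
  aut-aut⁻¹ v = proj₂ (proj₂ (proj₁ f-aut) v) refl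

  aut⁻¹-aut : ∀ v → aut⁻¹ (f v) ≡ v
  aut⁻¹-aut v = aut-injective (aut-aut⁻¹ (f v))

  aut-arc⇔ : ∀ u v → Γ u v ⇔ Γ (f u) (f v)
  aut-arc⇔ = proj₂ f-aut

  aut-preservesArcs : ∀ {u v} → Γ u v → Γ (f u) (f v)
  aut-preservesArcs = Equivalence.to (aut-arc⇔ _ _)

  aut-reflectsArcs : ∀ {u v} → Γ (f u) (f v) → Γ u v
  aut-reflectsArcs = Equivalence.from (aut-arc⇔ _ _)

  aut⁻¹-isAut : IsAut Γ aut⁻¹
  aut⁻¹-isAut = mkAut injective (λ v → f v , aut⁻¹-aut v) arcs
    where
      injective : ∀ {u v} → aut⁻¹ u ≡ aut⁻¹ v → u ≡ v
      injective {u} {v} e = trans (sym (aut-aut⁻¹ u)) (trans (cong f e) (aut-aut⁻¹ v))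

      arcs : ∀ u v → Γ u v ⇔ Γ (aut⁻¹ u) (aut⁻¹ v)
      arcs u v = mk⇔ (λ a → aut-reflectsArcs (subst₂ Γ (sym (aut-aut⁻¹ u)) (sym (aut-aut⁻¹ v)) a))
                     (λ a → subst₂ Γ (aut-aut⁻¹ u) (aut-aut⁻¹ v) (aut-preservesArcs a))

  aut-preservesConnection : ∀ {u v} → Star (SymClosure Γ) u v → Star (SymClosure Γ) (f u) (f v)
  aut-preservesConnection = gmap f (SymClosure.gmap f aut-preservesArcs)

  aut-preservesCoConnection : ∀ {u v} → Star (NonAdjacent Γ) u v → Star (NonAdjacent Γ) (f u) (f v)
  aut-preservesCoConnection = gmap f λ (¬uv , ¬vu) → ¬uv ∘ aut-reflectsArcs , ¬vu ∘ aut-reflectsArcs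

vertexTransitive : {V : Set} {Γ : Digraph V} {G : PermGroup V} →
                   Γ HasAutGroup G → IsTransitive G → VertexTransitive Γ
vertexTransitive aut G-transitive u v with G-transitive u v
... | f , f∈G , fu≡v = f , Equivalence.from (aut f) f∈G , fu≡v

FibrePreserving : {X Y : Set} → (X × Y → X × Y) → Set
FibrePreserving f = ∀ x y y' → proj₁ (f (x , y)) ≡ proj₁ (f (x , y'))

AutPreservesFibres : {X Y : Set} → Digraph (X × Y) → Set
AutPreservesFibres Γ = ∀ f → IsAut Γ f → FibrePreserving f

autPreservesFibres-via : ∀ {ℓ} {X Y : Set} {Γ : Digraph (X × Y)} (R : X × Y → X × Y → Set ℓ) →
                         (∀ {f} → IsAut Γ f → ∀ {u v} → R u v → R (f u) (f v)) →
                         (∀ {u v} → R u v → proj₁ u ≡ proj₁ v) →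
                         (∀ x y y' → R (x , y) (x , y')) →
                         AutPreservesFibres Γ
autPreservesFibres-via R R-invariant R⇒sameFibre sameFibre⇒R f f-aut x y y' =
  R⇒sameFibre (R-invariant f-aut (sameFibre⇒R x y y'))

star-sameFibre : ∀ {ℓ} {X Y : Set} {R : X × Y → X × Y → Set ℓ} →
                 (∀ {u v} → R u v → proj₁ u ≡ proj₁ v) → ∀ {u v} → Star R u v → proj₁ u ≡ proj₁ v
star-sameFibre R⇒sameFibre = fold (λ u v → proj₁ u ≡ proj₁ v) (λ r e → trans (R⇒sameFibre r) e) refl

≀ᵍ-map : {X Y : Set} {A A' : PermGroup X} {B B' : PermGroup Y} →
         (∀ {a} → A a → A' a) → (∀ {b} → B b → B' b) → ∀ {f} → (A ≀ᵍ B) f → (A' ≀ᵍ B') f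
≀ᵍ-map A⊆A' B⊆B' (a , b , a∈A , b∈B , f-split) = a , b , A⊆A' a∈A , (λ x → B⊆B' (b∈B x)) , f-split

≀ᵍ-transitive : {X Y : Set} {A : PermGroup X} {B : PermGroup Y} →
                IsTransitive A → IsTransitive B → IsTransitive (A ≀ᵍ B)
≀ᵍ-transitive A-transitive B-transitive (x , y) (x' , y')
  with A-transitive x x' | B-transitive y y'
... | a , a∈A , ax≡x' | b , b∈B , by≡y' =
  (λ (z , t) → a z , b t) , (a , (λ _ → b) , a∈A , (λ _ → b∈B) , λ _ _ → refl) , cong₂ _,_ ax≡x' by≡y'

WreathG-transitive : ∀ j (X : Fin (suc j) → Set) (G : (i : Fin (suc j)) → PermGroup (X i)) →
                     (∀ i → IsTransitive (G i)) → IsTransitive (WreathG j X G)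
WreathG-transitive zero    X G transitive = transitive Fin.zero
WreathG-transitive (suc j) X G transitive =
  ≀ᵍ-transitive (transitive Fin.zero) (WreathG-transitive j (X ∘ Fin.suc) (G ∘ Fin.suc) (transitive ∘ Fin.suc))

Vert-inhabited : ∀ j (X : Fin (suc j) → Set) → ((i : Fin (suc j)) → X i) → Vert j X
Vert-inhabited zero    X x = x Fin.zero
Vert-inhabited (suc j) X x = x Fin.zero , Vert-inhabited j (X ∘ Fin.suc) (x ∘ Fin.suc)

module _ {X Y : Set} {Γ₁ : Digraph X} {Γ₂ : Digraph Y} where

  ≀ᵈ-arc-within : Loopless Γ₁ → ∀ {x y y'} → (Γ₁ ≀ᵈ Γ₂) (x , y) (x , y') ⇔ Γ₂ y y'
  ≀ᵈ-arc-within loopless {x} =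
    mk⇔ (λ { (inj₁ (_ , a)) → a ; (inj₂ γ) → ⊥-elim (loopless x γ) }) (λ a → inj₁ (refl , a))

  ≀ᵈ-arc-across : ∀ {x x' y y'} → x ≢ x' → (Γ₁ ≀ᵈ Γ₂) (x , y) (x' , y') ⇔ Γ₁ x x'
  ≀ᵈ-arc-across x≢x' = mk⇔ (λ { (inj₁ (e , _)) → ⊥-elim (x≢x' e) ; (inj₂ γ) → γ }) inj₂

  ≀ᵈ-fibre-connected : ∀ {x y y'} → Star (SymClosure Γ₂) y y' →
                       Star (SymClosure (Γ₁ ≀ᵈ Γ₂)) (x , y) (x , y')
  ≀ᵈ-fibre-connected {x} = gmap (x ,_) (SymClosure.gmap (x ,_) λ a → inj₁ (refl , a))

  ≀ᵈ-fibre-coConnected : Loopless Γ₁ → ∀ {x y y'} → Star (NonAdjacent Γ₂) y y' →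
                         Star (NonAdjacent (Γ₁ ≀ᵈ Γ₂)) (x , y) (x , y')
  ≀ᵈ-fibre-coConnected loopless {x} = gmap (x ,_) λ (¬yy' , ¬y'y) →
    ¬yy' ∘ Equivalence.to (≀ᵈ-arc-within loopless) , ¬y'y ∘ Equivalence.to (≀ᵈ-arc-within loopless)

  ≀ᵈ-connected : (∀ x → Σ X (Γ₁ x)) → Connected Γ₁ → Connected (Γ₁ ≀ᵈ Γ₂)
  ≀ᵈ-connected out connected (x , y) (x' , y') = lift (connected x x') y y'
    where
      lift : ∀ {x x'} → Star (SymClosure Γ₁) x x' → ∀ y y' → Star (SymClosure (Γ₁ ≀ᵈ Γ₂)) (x , y) (x' , y')
      lift {x} ε y y' = _◅_ {j = proj₁ (out x) , y} (fwd (inj₂ (proj₂ (out x)))) (bwd (inj₂ (proj₂ (out x))) ◅ ε)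
      lift (fwd γ ◅ p) y y' = fwd (inj₂ γ) ◅ lift p y' y'
      lift (bwd γ ◅ p) y y' = bwd (inj₂ γ) ◅ lift p y' y'

module _ {X Y : Set} {Γ₁ : Digraph X} {Γ₂ : Digraph Y} where

  Aut≀Aut⊆Aut-≀ᵈ : ∀ {f} → (Aut Γ₁ ≀ᵍ Aut Γ₂) f → IsAut (Γ₁ ≀ᵈ Γ₂) f
  Aut≀Aut⊆Aut-≀ᵈ {f} (a , b , a-aut , b-aut , f-split) = mkAut injective surjective arcs
    where
      split-injective : ∀ {x y x' y'} → (a x , b x y) ≡ (a x' , b x' y') → (x , y) ≡ (x' , y')
      split-injective {x} e with aut-injective a-aut (cong proj₁ e)
      ... | refl = cong (x ,_) (aut-injective (b-aut x) (cong proj₂ e))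

      injective : ∀ {u v} → f u ≡ f v → u ≡ v
      injective {x , y} {x' , y'} e = split-injective (trans (sym (f-split x y)) (trans e (f-split x' y')))

      surjective : ∀ v → Σ (X × Y) λ u → f u ≡ v
      surjective (x' , y') = (x , y) , trans (f-split x y) (cong₂ _,_ (aut-aut⁻¹ a-aut x') (aut-aut⁻¹ (b-aut x) y'))
        where
          x = aut⁻¹ a-aut x'
          y = aut⁻¹ (b-aut x) y'

      split-arc⇒ : ∀ {x y x' y'} → (Γ₁ ≀ᵈ Γ₂) (x , y) (x' , y') → (Γ₁ ≀ᵈ Γ₂) (a x , b x y) (a x' , b x' y')
      split-arc⇒ {x} (inj₁ (refl , arc)) = inj₁ (refl , aut-preservesArcs (b-aut x) arc)
      split-arc⇒     (inj₂ γ)            = inj₂ (aut-preservesArcs a-aut γ)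

      split-arc⇐ : ∀ {x y x' y'} → (Γ₁ ≀ᵈ Γ₂) (a x , b x y) (a x' , b x' y') → (Γ₁ ≀ᵈ Γ₂) (x , y) (x' , y')
      split-arc⇐ {x} (inj₁ (e , arc)) with aut-injective a-aut e
      ... | refl = inj₁ (refl , aut-reflectsArcs (b-aut x) arc)
      split-arc⇐ (inj₂ γ) = inj₂ (aut-reflectsArcs a-aut γ)

      arcs : ∀ u v → (Γ₁ ≀ᵈ Γ₂) u v ⇔ (Γ₁ ≀ᵈ Γ₂) (f u) (f v)
      arcs (x , y) (x' , y') = subst₂ (λ u v → (Γ₁ ≀ᵈ Γ₂) (x , y) (x' , y') ⇔ (Γ₁ ≀ᵈ Γ₂) u v)
                                      (sym (f-split x y)) (sym (f-split x' y')) (mk⇔ split-arc⇒ split-arc⇐)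

module FibredAutomorphism {X Y : Set} {Γ₁ : Digraph X} {Γ₂ : Digraph Y} (loopless : Loopless Γ₁)
  {f : X × Y → X × Y} (f-aut : IsAut (Γ₁ ≀ᵈ Γ₂) f)
  (f-fibred : FibrePreserving f) (f⁻¹-fibred : FibrePreserving (aut⁻¹ f-aut)) (y₀ : Y) where

  base : X → X
  base x = proj₁ (f (x , y₀))

  fibreMap : X → Y → Y
  fibreMap x y = proj₂ (f (x , y))

  f-split : ∀ x y → f (x , y) ≡ (base x , fibreMap x y)
  f-split x y = cong (_, fibreMap x y) (f-fibred x y y₀)

  split-arc⇔ : ∀ {x y x' y'} →
               (Γ₁ ≀ᵈ Γ₂) (x , y) (x' , y') ⇔ (Γ₁ ≀ᵈ Γ₂) (base x , fibreMap x y) (base x' , fibreMap x' y')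
  split-arc⇔ {x} {y} {x'} {y'} = subst₂ (λ u v → (Γ₁ ≀ᵈ Γ₂) (x , y) (x' , y') ⇔ (Γ₁ ≀ᵈ Γ₂) u v)
                                        (f-split x y) (f-split x' y') (aut-arc⇔ f-aut _ _)

  base-injective : ∀ {x x'} → base x ≡ base x' → x ≡ x'
  base-injective {x} {x'} e = begin
    x                                     ≡⟨ cong proj₁ (aut⁻¹-aut f-aut (x , y₀)) ⟨
    proj₁ (g (f (x , y₀)))                ≡⟨ cong (proj₁ ∘ g) (f-split x y₀) ⟩
    proj₁ (g (base x , fibreMap x y₀))    ≡⟨ f⁻¹-fibred (base x) (fibreMap x y₀) (fibreMap x' y₀) ⟩
    proj₁ (g (base x , fibreMap x' y₀))   ≡⟨ cong (λ b → proj₁ (g (b , fibreMap x' y₀))) e ⟩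
    proj₁ (g (base x' , fibreMap x' y₀))  ≡⟨ cong (proj₁ ∘ g) (f-split x' y₀) ⟨
    proj₁ (g (f (x' , y₀)))               ≡⟨ cong proj₁ (aut⁻¹-aut f-aut (x' , y₀)) ⟩
    x'                                    ∎
    where
      open ≡-Reasoning
      g = aut⁻¹ f-aut

  split-preimage : ∀ x' y' → Σ X λ x → Σ Y λ y → base x ≡ x' × fibreMap x y ≡ y'
  split-preimage x' y' = proj₁ u , proj₂ u , cong proj₁ fu≡v , cong proj₂ fu≡v
    where
      u = aut⁻¹ f-aut (x' , y')
      fu≡v = trans (sym (f-split (proj₁ u) (proj₂ u))) (aut-aut⁻¹ f-aut (x' , y'))

  base-arc⇔ : ∀ {x x'} → x ≢ x' → Γ₁ x x' ⇔ Γ₁ (base x) (base x')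
  base-arc⇔ {x} {x'} x≢x' =
    ≀ᵈ-arc-across {Γ₁ = Γ₁} {Γ₂ = Γ₂} {y = fibreMap x y₀} {y' = fibreMap x' y₀} (x≢x' ∘ base-injective)
               ⇔-∘ (split-arc⇔ ⇔-∘ ⇔-sym (≀ᵈ-arc-across {Γ₁ = Γ₁} {Γ₂ = Γ₂} {y = y₀} {y' = y₀} x≢x'))

  base-isAut : IsAut Γ₁ base
  base-isAut = mkAut base-injective surjective arcs
    where
      surjective : ∀ x' → Σ X λ x → base x ≡ x'
      surjective x' with split-preimage x' y₀
      ... | x , _ , bx≡x' , _ = x , bx≡x'

      arcs : ∀ x x' → Γ₁ x x' ⇔ Γ₁ (base x) (base x')
      arcs x x' = mk⇔ (λ γ → Equivalence.to (base-arc⇔ λ { refl → loopless x γ }) γ)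
                      (λ γ → Equivalence.from (base-arc⇔ λ { refl → loopless (base x) γ }) γ)

  fibreMap-isAut : ∀ x → IsAut Γ₂ (fibreMap x)
  fibreMap-isAut x = mkAut injective surjective arcs
    where
      injective : ∀ {y y'} → fibreMap x y ≡ fibreMap x y' → y ≡ y'
      injective {y} {y'} e =
        cong proj₂ (aut-injective f-aut (trans (f-split x y) (trans (cong (base x ,_) e) (sym (f-split x y')))))

      surjective : ∀ y' → Σ Y λ y → fibreMap x y ≡ y'
      surjective y' with split-preimage (base x) y'
      ... | x₁ , y , bx₁≡bx , e with base-injective bx₁≡bx
      ... | refl = y , e

      arcs : ∀ y y' → Γ₂ y y' ⇔ Γ₂ (fibreMap x y) (fibreMap x y')
      arcs y y' = ≀ᵈ-arc-within {Γ₁ = Γ₁} {Γ₂ = Γ₂} loopless {base x}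
              ⇔-∘ (split-arc⇔ ⇔-∘ ⇔-sym (≀ᵈ-arc-within {Γ₁ = Γ₁} {Γ₂ = Γ₂} loopless {x}))

  ∈Aut≀Aut : (Aut Γ₁ ≀ᵍ Aut Γ₂) f
  ∈Aut≀Aut = base , fibreMap , base-isAut , fibreMap-isAut , f-split

≀ᵈ-hasAutGroup : {X Y : Set} {Γ₁ : Digraph X} {Γ₂ : Digraph Y} {A : PermGroup X} {B : PermGroup Y} →
                 Y → Loopless Γ₁ → AutPreservesFibres (Γ₁ ≀ᵈ Γ₂) →
                 Γ₁ HasAutGroup A → Γ₂ HasAutGroup B → (Γ₁ ≀ᵈ Γ₂) HasAutGroup (A ≀ᵍ B)
≀ᵈ-hasAutGroup {Γ₂ = Γ₂} y₀ loopless fibres autA autB f = mk⇔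
  (λ f-aut → ≀ᵍ-map (λ {a} → Equivalence.to (autA a)) (λ {b} → Equivalence.to (autB b))
               (FibredAutomorphism.∈Aut≀Aut {Γ₂ = Γ₂} loopless f-aut (fibres f f-aut)
                                             (fibres _ (aut⁻¹-isAut f-aut)) y₀))
  (λ f∈A≀B → Aut≀Aut⊆Aut-≀ᵈ (≀ᵍ-map (λ {a} → Equivalence.from (autA a)) (λ {b} → Equivalence.from (autB b)) f∈A≀B))

record ModuleMates {V : Set} (Γ : Digraph V) (u v : V) : Set₁ where
  field
    S           : V → Set
    isOutModule : ∀ {s s' w} → S s → S s' → ¬ S w → Γ s w → Γ s' w
    u∈S         : S u
    v∈S         : S v
    sink        : V
    sink∉S      : ¬ S sink
    →sink       : ∀ {s} → S s → Γ s sink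

module _ {V : Set} {Γ : Digraph V} where

  moduleMates-sym : ∀ {u v} → ModuleMates Γ u v → ModuleMates Γ v u
  moduleMates-sym mates = record { ModuleMates mates; u∈S = ModuleMates.v∈S mates; v∈S = ModuleMates.u∈S mates }

  moduleMates-aut : ∀ {f} → IsAut Γ f → ∀ {u v} → ModuleMates Γ u v → ModuleMates Γ (f u) (f v)
  moduleMates-aut {f} f-aut mates = record
    { S           = S ∘ g
    ; isOutModule = λ s∈ s'∈ w∉ γ → aut-reflectsArcs g-aut (isOutModule s∈ s'∈ w∉ (aut-preservesArcs g-aut γ))
    ; u∈S         = subst S (sym (aut⁻¹-aut f-aut _)) u∈S
    ; v∈S         = subst S (sym (aut⁻¹-aut f-aut _)) v∈S
    ; sink        = f sink
    ; sink∉S      = λ gfsink∈S → sink∉S (subst S (aut⁻¹-aut f-aut sink) gfsink∈S)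
    ; →sink       = λ {s} gs∈S →
        aut-reflectsArcs g-aut (subst (Γ (g s)) (sym (aut⁻¹-aut f-aut sink)) (→sink gs∈S))
    }
    where
      open ModuleMates mates
      g = aut⁻¹ f-aut
      g-aut = aut⁻¹-isAut f-aut

fibre-moduleMates : {X Y : Set} {Γ₁ : Digraph X} {Γ₂ : Digraph Y} → Loopless Γ₁ → (∀ x → Σ X (Γ₁ x)) →
                    ∀ x y y' → ModuleMates (Γ₁ ≀ᵈ Γ₂) (x , y) (x , y')
fibre-moduleMates {Γ₁ = Γ₁} loopless out x y y' = record
  { S           = λ u → proj₁ u ≡ x
  ; isOutModule = λ { refl refl w∉S (inj₁ (e , _)) → ⊥-elim (w∉S (sym e))
                    ; refl refl _   (inj₂ γ)       → inj₂ γ }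
  ; u∈S         = refl
  ; v∈S         = refl
  ; sink        = proj₁ (out x) , y
  ; sink∉S      = λ e → loopless x (subst (Γ₁ x) e (proj₂ (out x)))
  ; →sink       = λ { refl → inj₂ (proj₂ (out x)) }
  }

⟨1⟩ : {m : ℕ} → Fin m → Bool
⟨1⟩ s = toℕ s ≡ᵇ 1

∅ : {m : ℕ} → Fin m → Bool
∅ _ = false

Cycle : (n : ℕ) → Digraph (Fin (2 + n))
Cycle n = Cay (2 + n) ⟨1⟩

Cay-translate⇔ : ∀ {n} (S : Fin (suc n) → Bool) {g h} c → Cay (suc n) S g h ⇔ Cay (suc n) S (g ⊕ c) (h ⊕ c)
Cay-translate⇔ S {g} c = mk⇔
  (λ (s , s∈S , h≡g⊕s) → s , s∈S , trans (cong (_⊕ c) h≡g⊕s) ([x⊕y]⊕z≡[x⊕z]⊕y g s c))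
  (λ (s , s∈S , e) → s , s∈S , ⊕-cancelʳ (trans e (sym ([x⊕y]⊕z≡[x⊕z]⊕y g s c))))

Cyc⊆Aut-Cay : ∀ {n} (S : Fin (suc n) → Bool) {f} → Cyc (suc n) f → IsAut (Cay (suc n) S) f
Cyc⊆Aut-Cay S {f} (c , f≡⊕c) = mkAut injective (λ y → y ⊕ ⊖ c , trans (f≡⊕c _) ([x⊕⊖c]⊕c≡x y c)) arcs
  where
    injective : ∀ {x y} → f x ≡ f y → x ≡ y
    injective {x} {y} e = ⊕-cancelʳ (trans (sym (f≡⊕c x)) (trans e (f≡⊕c y)))

    arcs : ∀ g h → Cay _ S g h ⇔ Cay _ S (f g) (f h)
    arcs g h = subst₂ (λ a b → Cay _ S g h ⇔ Cay _ S a b) (sym (f≡⊕c g)) (sym (f≡⊕c h)) (Cay-translate⇔ S {g} {h} c)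

Cyc-transitive : ∀ m → 0 < m → IsTransitive (Cyc m)
Cyc-transitive (suc n) _ x x' = (_⊕ c) , (c , λ _ → refl) , trans (⊕-comm x c) ([x⊕⊖c]⊕c≡x x' x)
  where c = x' ⊕ ⊖ x

module _ {n : ℕ} where

  𝟙 : Fin (2 + n)
  𝟙 = Fin.suc Fin.zero

  ⊕𝟙≢ : (x : Fin (2 + n)) → x ⊕ 𝟙 ≢ x
  ⊕𝟙≢ x e with ⊕-fixed⇒zero e
  ... | ()

  private
    residue : ℕ → Fin (2 + n)
    residue r = r mod (2 + n)

    residue-suc : ∀ r → residue (suc r) ≡ residue r ⊕ 𝟙
    residue-suc r = mod-cong (suc r) (toℕ (residue r) + 1) (sym (begin
      (toℕ (residue r) + 1) % (2 + n) ≡⟨ cong (λ a → (a + 1) % (2 + n)) (toℕ-fromℕ< (m%n<n r (2 + n))) ⟩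
      (r % (2 + n) + 1) % (2 + n)     ≡⟨ %-absorbˡ r 1 ⟩
      (r + 1) % (2 + n)               ≡⟨ cong (_% (2 + n)) (+-comm r 1) ⟩
      suc r % (2 + n)                 ∎))
      where open ≡-Reasoning

    residue-toℕ : (x : Fin (2 + n)) → residue (toℕ x) ≡ x
    residue-toℕ x = toℕ-injective (trans (toℕ-fromℕ< _) (m<n⇒m%n≡m (toℕ<n x)))

  ⊕𝟙-induction : ∀ {ℓ} (P : Fin (2 + n) → Set ℓ) → P Fin.zero → (∀ x → P x → P (x ⊕ 𝟙)) → ∀ x → P x
  ⊕𝟙-induction P P0 P-step x = subst P (residue-toℕ x) (P-residue (toℕ x))
    where
      P-residue : ∀ r → P (residue r)
      P-residue zero    = P0
      P-residue (suc r) = subst P (sym (residue-suc r)) (P-step (residue r) (P-residue r))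

  cycle-arc⇒ : ∀ x {x'} → Cycle n x x' → x' ≡ x ⊕ 𝟙
  cycle-arc⇒ x (s , s∈⟨1⟩ , e) = trans e (cong (x ⊕_) (⟨1⟩-member s∈⟨1⟩))
    where
      ⟨1⟩-member : ∀ {s} → ⟨1⟩ s ≡ true → s ≡ 𝟙
      ⟨1⟩-member {s} e = toℕ-injective (≡ᵇ⇒≡ (toℕ s) 1 (subst T (sym e) tt))

  cycle-succ : ∀ x → Cycle n x (x ⊕ 𝟙)
  cycle-succ x = 𝟙 , refl , refl

  cycle-loopless : Loopless (Cycle n)
  cycle-loopless x γ = ⊕𝟙≢ x (sym (cycle-arc⇒ x γ))

  cycle-connected : Connected (Cycle n)
  cycle-connected u v = reverse (symmetric _) (from-zero u) ◅◅ from-zero v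
    where
      from-zero : ∀ x → Star (SymClosure (Cycle n)) Fin.zero x
      from-zero = ⊕𝟙-induction _ ε λ x p → p ◅◅ (fwd (cycle-succ x) ◅ ε)

  cycle-autGroup : Cycle n HasAutGroup Cyc (2 + n)
  cycle-autGroup f = mk⇔ (λ f-aut → arcPreserving⇒translation (aut-preservesArcs f-aut)) (Cyc⊆Aut-Cay ⟨1⟩)
    where
      arcPreserving⇒translation : ∀ {a} → (∀ {x x'} → Cycle n x x' → Cycle n (a x) (a x')) → Cyc (2 + n) a
      arcPreserving⇒translation {a} a-arc = a Fin.zero , ⊕𝟙-induction _ (sym (⊕-identityˡ (a Fin.zero))) step
        where
          open ≡-Reasoning
          step : ∀ x → a x ≡ x ⊕ a Fin.zero → a (x ⊕ 𝟙) ≡ (x ⊕ 𝟙) ⊕ a Fin.zero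
          step x e = begin
            a (x ⊕ 𝟙)             ≡⟨ cycle-arc⇒ (a x) (a-arc (cycle-succ x)) ⟩
            a x ⊕ 𝟙               ≡⟨ cong (_⊕ 𝟙) e ⟩
            (x ⊕ a Fin.zero) ⊕ 𝟙  ≡⟨ [x⊕y]⊕z≡[x⊕z]⊕y x (a Fin.zero) 𝟙 ⟩
            (x ⊕ 𝟙) ⊕ a Fin.zero  ∎

  cycle-≀ᵈ-connected : {Y : Set} {Γ' : Digraph Y} → Connected (Cycle n ≀ᵈ Γ')
  cycle-≀ᵈ-connected = ≀ᵈ-connected (λ x → x ⊕ 𝟙 , cycle-succ x) cycle-connected

  ∅-arcless : ∀ x {x'} → ¬ Cay (2 + n) ∅ x x'
  ∅-arcless _ (_ , () , _)

  module _ {Y : Set} {Γ' : Digraph Y} where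

    ∅-≀ᵈ-autPreservesFibres : Connected Γ' → AutPreservesFibres (Cay (2 + n) ∅ ≀ᵈ Γ')
    ∅-≀ᵈ-autPreservesFibres connected =
      autPreservesFibres-via (Star (SymClosure (Cay (2 + n) ∅ ≀ᵈ Γ'))) aut-preservesConnection
        (star-sameFibre λ { (fwd arc) → arc⇒sameFibre arc ; (bwd arc) → sym (arc⇒sameFibre arc) })
        (λ x y y' → ≀ᵈ-fibre-connected (connected y y'))
      where
        arc⇒sameFibre : ∀ {u v} → (Cay (2 + n) ∅ ≀ᵈ Γ') u v → proj₁ u ≡ proj₁ v
        arc⇒sameFibre (inj₁ (e , _))     = e
        arc⇒sameFibre {u} (inj₂ γ) = ⊥-elim (∅-arcless (proj₁ u) γ)

    ∅-≀ᵈ-nonAdjacent : ∀ {x x'} y y' → x ≢ x' → NonAdjacent (Cay (2 + n) ∅ ≀ᵈ Γ') (x , y) (x' , y')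
    ∅-≀ᵈ-nonAdjacent {x} {x'} y y' x≢x' =
        ∅-arcless x ∘ Equivalence.to (≀ᵈ-arc-across {Γ₁ = Cay (2 + n) ∅} {Γ₂ = Γ'} {y = y} {y' = y'} x≢x')
      , ∅-arcless x' ∘ Equivalence.to (≀ᵈ-arc-across {Γ₁ = Cay (2 + n) ∅} {Γ₂ = Γ'} {y = y'} {y' = y} (≢-sym x≢x'))

    ∅-≀ᵈ-coConnected : CoConnected (Cay (2 + n) ∅ ≀ᵈ Γ')
    ∅-≀ᵈ-coConnected (x , y) (x' , y') with x ≟ x'
    ... | no x≢x'  = ∅-≀ᵈ-nonAdjacent y y' x≢x' ◅ ε
    ... | yes refl = ∅-≀ᵈ-nonAdjacent y y (≢-sym (⊕𝟙≢ x)) ◅ ∅-≀ᵈ-nonAdjacent y y' (⊕𝟙≢ x) ◅ ε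

≢⇒≡⊕𝟙 : ∀ {x x' : Fin 2} → x ≢ x' → x' ≡ x ⊕ 𝟙
≢⇒≡⊕𝟙 {Fin.zero}          {Fin.zero}          x≢x' = ⊥-elim (x≢x' refl)
≢⇒≡⊕𝟙 {Fin.zero}          {Fin.suc Fin.zero}  _    = refl
≢⇒≡⊕𝟙 {Fin.suc Fin.zero}  {Fin.zero}          _    = refl
≢⇒≡⊕𝟙 {Fin.suc Fin.zero}  {Fin.suc Fin.zero}  x≢x' = ⊥-elim (x≢x' refl)

∅₂-autGroup : Cay 2 ∅ HasAutGroup Cyc 2
∅₂-autGroup f = mk⇔ (λ f-aut → injective⇒translation (aut-injective f-aut)) (Cyc⊆Aut-Cay ∅)
  where
    injective⇒translation : ∀ {a : Fin 2 → Fin 2} → (∀ {x y} → a x ≡ a y → x ≡ y) → Cyc 2 a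
    injective⇒translation {a} injective = a Fin.zero , λ where
      Fin.zero           → sym (⊕-identityˡ (a Fin.zero))
      (Fin.suc Fin.zero) → trans (≢⇒≡⊕𝟙 (0≢1+n ∘ injective)) (⊕-comm (a Fin.zero) 𝟙)

module _ {Y : Set} {Γ' : Digraph Y} where

  K₂-≀ᵈ-autPreservesFibres : CoConnected Γ' → AutPreservesFibres (Cycle 0 ≀ᵈ Γ')
  K₂-≀ᵈ-autPreservesFibres coConnected =
    autPreservesFibres-via (Star (NonAdjacent (Cycle 0 ≀ᵈ Γ'))) aut-preservesCoConnection
      (star-sameFibre nonAdjacent⇒sameFibre)
      (λ x y y' → ≀ᵈ-fibre-coConnected cycle-loopless (coConnected y y'))
    where
      nonAdjacent⇒sameFibre : ∀ {u v} → NonAdjacent (Cycle 0 ≀ᵈ Γ') u v → proj₁ u ≡ proj₁ v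
      nonAdjacent⇒sameFibre {x , _} {x' , _} (¬uv , _) with x ≟ x'
      ... | yes x≡x' = x≡x'
      ... | no x≢x'  = ⊥-elim (¬uv (inj₂ (𝟙 , refl , ≢⇒≡⊕𝟙 x≢x')))

module _ {n : ℕ} {Y : Set} {Γ' : Digraph Y} where

  ⊕𝟙⊕𝟙≢ : (x : Fin (3 + n)) → (x ⊕ 𝟙) ⊕ 𝟙 ≢ x
  ⊕𝟙⊕𝟙≢ x e with ⊕-fixed⇒zero (trans (sym (⊕-assoc x 𝟙 𝟙)) e)
  ... | ()

  cycle-≀ᵈ-fibreStep : ∀ {u v} → (Cycle (suc n) ≀ᵈ Γ') u v → proj₁ v ≡ proj₁ u ⊎ proj₁ v ≡ proj₁ u ⊕ 𝟙
  cycle-≀ᵈ-fibreStep     (inj₁ (e , _)) = inj₁ (sym e)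
  cycle-≀ᵈ-fibreStep {u} (inj₂ γ)       = inj₂ (cycle-arc⇒ (proj₁ u) γ)

  -- With the sink in fibre x ⊕ 𝟙, the vertex z two fibres ahead of x can be neither in the
  -- module (z has no arc to the sink) nor outside it (the member in fibre x ⊕ 𝟙 points to z,
  -- the member in fibre x does not); both exclusions need m ≥ 3.
  consecutive-not-moduleMates : ∀ {x y x' y'} (mates : ModuleMates (Cycle (suc n) ≀ᵈ Γ') (x , y) (x' , y')) →
                                x' ≡ x ⊕ 𝟙 → proj₁ (ModuleMates.sink mates) ≡ x' → ⊥
  consecutive-not-moduleMates {x} {y} {_} {y'} mates refl sink≡ = ¬¬z∈S z∉S
    where
      open ModuleMates mates
      z = (x ⊕ 𝟙) ⊕ 𝟙 , y'

      z∉S : ¬ S z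
      z∉S z∈S with cycle-≀ᵈ-fibreStep (→sink z∈S)
      ... | inj₁ e = ⊕𝟙≢ (x ⊕ 𝟙) (trans (sym e) sink≡)
      ... | inj₂ e = ⊕𝟙⊕𝟙≢ (x ⊕ 𝟙) (trans (sym e) sink≡)

      ¬¬z∈S : ¬ ¬ S z
      ¬¬z∈S z∉S with cycle-≀ᵈ-fibreStep (isOutModule v∈S u∈S z∉S (inj₂ (cycle-succ (x ⊕ 𝟙))))
      ... | inj₁ e = ⊕𝟙⊕𝟙≢ x e
      ... | inj₂ e = ⊕𝟙≢ (x ⊕ 𝟙) e

  cycle-≀ᵈ-moduleMates⇒sameFibre : ∀ {u v} → ModuleMates (Cycle (suc n) ≀ᵈ Γ') u v → proj₁ u ≡ proj₁ v
  cycle-≀ᵈ-moduleMates⇒sameFibre {x , _} {x' , _} mates =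
    compare (cycle-≀ᵈ-fibreStep (→sink u∈S)) (cycle-≀ᵈ-fibreStep (→sink v∈S))
    where
      open ModuleMates mates
      compare : proj₁ sink ≡ x ⊎ proj₁ sink ≡ x ⊕ 𝟙 → proj₁ sink ≡ x' ⊎ proj₁ sink ≡ x' ⊕ 𝟙 → x ≡ x'
      compare (inj₁ s≡x)   (inj₁ s≡x')   = trans (sym s≡x) s≡x'
      compare (inj₂ s≡x⊕𝟙) (inj₂ s≡x'⊕𝟙) = ⊕-cancelʳ (trans (sym s≡x⊕𝟙) s≡x'⊕𝟙)
      compare (inj₂ s≡x⊕𝟙) (inj₁ s≡x')   =
        ⊥-elim (consecutive-not-moduleMates mates (trans (sym s≡x') s≡x⊕𝟙) s≡x')
      compare (inj₁ s≡x)   (inj₂ s≡x'⊕𝟙) =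
        ⊥-elim (consecutive-not-moduleMates (moduleMates-sym mates) (trans (sym s≡x) s≡x'⊕𝟙) s≡x)

  cycle-≀ᵈ-autPreservesFibres : AutPreservesFibres (Cycle (suc n) ≀ᵈ Γ')
  cycle-≀ᵈ-autPreservesFibres =
    autPreservesFibres-via (ModuleMates (Cycle (suc n) ≀ᵈ Γ')) moduleMates-aut cycle-≀ᵈ-moduleMates⇒sameFibre
      (fibre-moduleMates cycle-loopless (λ x → x ⊕ 𝟙 , cycle-succ x))

circulant : ∀ m → 2 ≤ m → Σ (Fin m → Bool) λ S → Cay m S HasAutGroup Cyc m × ConnectedOrCoConnected (Cay m S)
circulant (suc (suc n)) _ = ⟨1⟩ , cycle-autGroup , inj₁ cycle-connected
circulant 1 (s≤s ())

circulant-≀ᵈ : ∀ m → 2 ≤ m → {Y : Set} {Γ' : Digraph Y} {G' : PermGroup Y} →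
               Y → Γ' HasAutGroup G' → ConnectedOrCoConnected Γ' →
               Σ (Fin m → Bool) λ S → (Cay m S ≀ᵈ Γ') HasAutGroup (Cyc m ≀ᵍ G')
                                     × ConnectedOrCoConnected (Cay m S ≀ᵈ Γ')
circulant-≀ᵈ (suc (suc (suc n))) _ y₀ aut _ =
  ⟨1⟩ , ≀ᵈ-hasAutGroup y₀ cycle-loopless cycle-≀ᵈ-autPreservesFibres cycle-autGroup aut , inj₁ cycle-≀ᵈ-connected
circulant-≀ᵈ 2 _ y₀ aut (inj₁ connected) =
  ∅ , ≀ᵈ-hasAutGroup y₀ (λ x → ∅-arcless x) (∅-≀ᵈ-autPreservesFibres connected) ∅₂-autGroup aut , inj₂ ∅-≀ᵈ-coConnected
circulant-≀ᵈ 2 _ y₀ aut (inj₂ coConnected) =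
  ⟨1⟩ , ≀ᵈ-hasAutGroup y₀ cycle-loopless (K₂-≀ᵈ-autPreservesFibres coConnected) cycle-autGroup aut , inj₁ cycle-≀ᵈ-connected
circulant-≀ᵈ 1 (s≤s ())

iteratedCirculant-≀ᵈ : ∀ j (m : Fin (suc j) → ℕ) → (∀ i → 2 ≤ m i) →
  Σ ((i : Fin (suc j)) → Fin (m i) → Bool) λ S →
    WreathD j (λ i → Fin (m i)) (λ i → Cay (m i) (S i)) HasAutGroup WreathG j (λ i → Fin (m i)) (λ i → Cyc (m i))
    × ConnectedOrCoConnected (WreathD j (λ i → Fin (m i)) (λ i → Cay (m i) (S i)))
iteratedCirculant-≀ᵈ zero m 2≤m with circulant (m Fin.zero) (2≤m Fin.zero)
... | S , aut , connectivity = (λ { Fin.zero → S }) , aut , connectivity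
iteratedCirculant-≀ᵈ (suc j) m 2≤m with iteratedCirculant-≀ᵈ j (m ∘ Fin.suc) (2≤m ∘ Fin.suc)
... | S' , aut' , connectivity' with circulant-≀ᵈ (m Fin.zero) (2≤m Fin.zero) vertex aut' connectivity'
  where vertex = Vert-inhabited j _ λ i → fromℕ< (<⇒≤ (2≤m (Fin.suc i)))
...   | S , aut , connectivity = (λ { Fin.zero → S ; (Fin.suc i) → S' i }) , aut , connectivity

2≤prime^k : ∀ {p k} → Prime p → 1 ≤ k → 2 ≤ p ^ k
2≤prime^k {p} {k} p-prime 1≤k =
  ≤-trans (^-monoʳ-≤ 2 1≤k) (^-monoˡ-≤ k (nonTrivial⇒n>1 p {{prime⇒nonTrivial p-prime}}))

lemma3p1 : (p : ℕ) → Prime p → (j : ℕ) → (k : Fin (suc j) → ℕ) → (∀ i → 1 ≤ k i) →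
    Σ ((i : Fin (suc j)) → Fin (p ^ k i) → Bool) λ S →
      VertexTransitive (WreathD j (λ i → Fin (p ^ k i)) (λ i → Cay (p ^ k i) (S i)))
      × (∀ f → IsAut (WreathD j (λ i → Fin (p ^ k i)) (λ i → Cay (p ^ k i) (S i))) f
               ⇔ WreathG j (λ i → Fin (p ^ k i)) (λ i → Cyc (p ^ k i)) f)
lemma3p1 p p-prime j k 1≤k = S , vertexTransitive aut transitive , aut
  where
    2≤p^k : ∀ i → 2 ≤ p ^ k i
    2≤p^k i = 2≤prime^k p-prime (1≤k i)

    circulants = iteratedCirculant-≀ᵈ j (λ i → p ^ k i) 2≤p^k
    S = proj₁ circulants
    aut = proj₁ (proj₂ circulants)

    transitive : IsTransitive (WreathG j (λ i → Fin (p ^ k i)) (λ i → Cyc (p ^ k i)))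
    transitive = WreathG-transitive j _ _ λ i → Cyc-transitive (p ^ k i) (<⇒≤ (2≤p^k i))
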